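{- There exist finite, Boolean, but non-static clean maps that exhibit nontrivial recurrence. Precisely: there exist a countable set of atoms $\Phi$, a finite set of agents $I$, a normal modal logic $\Lambda$ over $\mathcal{L}$, an $\mathcal{L}_\Lambda$ modal space $\mathbf{X}$, a clean map $\mathbf{f}:\mathbf{X}\to\mathbf{X}$ based on a finite multi-pointed action model all of whose preconditions are Boolean and at least one of whose postconditions is not $\top$, and a point $\mathbf{x}\in\mathbf{X}$ such that the orbit $\mathcal{O}_{\mathbf{f}}(\mathbf{x})$ is not periodic and contains a recurrent point.
   Context: Let $\Phi$ be a countable set of atoms and $I$ a finite set of agents. The language $\mathcal{L}$ is $\varphi ::= \top \mid p \mid \neg\varphi \mid \varphi\wedge\varphi \mid \Box_i\varphi$ ($p\in\Phi$, $i\in I$). A logic $\Lambda$ is any extension of the minimal normal modal logic $K$ over $\mathcal{L}$; $\boldsymbol{\varphi}$ denotes the class of formulas $\Lambda$-provably equivalent to $\varphi$ and $\mathcal{L}_\Lambda$ the set of these classes. Kripke models have a countable non-empty state set, relations $R_i$ ($i\in I$) and a valuation of $\Phi$; pointed models $Ms$, standard semantics. For a set $X$ of pointed Kripke models, the $\mathcal{L}_\Lambda$ modal space is $\mathbf{X}=\{\mathbf{x}:x\in X\}$, $\mathbf{x}=\{y\in X: y\models\varphi\text{ iff }x\models\varphi\text{ for all }\boldsymbol{\varphi}\in\mathcal{L}_\Lambda\}$, equipped with the Stone topology generated by the basis $U_{\boldsymbol{\varphi}}=\{\mathbf{x}:x\models\varphi\}$. Clean maps: a multi-pointed action model $\Sigma\Gamma=([\![\Sigma]\!],\mathsf{R},pre,post,\Gamma)$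 has a countable non-empty action set, relations $\mathsf{R}_i$, $pre,post:[\![\Sigma]\!]\to\mathcal{L}$ with each $post(\sigma)$ equal to $\top$ or a conjunction of literals, and $\emptyset\neq\Gamma\subseteq[\![\Sigma]\!]$. Precondition finite: $\{\boldsymbol{pre(\sigma)}\}$ finite; exhaustive over $X$: each $x\in X$ satisfies some $pre(\sigma)$, $\sigma\in\Gamma$; deterministic over $X$: no $x\in X$ satisfies $pre(\sigma)\wedge pre(\sigma')$ for distinct $\sigma,\sigma'\in\Gamma$. Product update $Ms\otimes\Sigma\Gamma$: states $\{(s,\sigma):Ms\models pre(\sigma)\}$, $R'_i=\{((s,\sigma),(t,\tau)):(s,t)\in R_i,(\sigma,\tau)\in\mathsf{R}_i\}$, $[\![p]\!]'=\{(s,\sigma):s\in[\![p]\!],post(\sigma)\not\models\neg p\}\cup\{(s,\sigma):post(\sigma)\models p\}$, designated $(s,\sigma)$ with $\sigma\in\Gamma$ the unique action with $Ms\models pre(\sigma)$. Closing over $X$: $x\otimes\Sigma\Gamma\in X$ for all $x\in X$. $\mathbf{f}$ is clean if such a precondition finite $\Sigma\Gamma$, closing, deterministic and exhaustive over $X$, satisfies $\mathbf{f}(\mathbf{x})=\mathbf{y}$ iff $x\otimes\Sigma\Gamma\in\mathbf{y}$. The action model is finite if $[\![\Sigma]\!]$ is finite, Boolean if every precondition is modality-free, static if every postcondition is $\top$. The orbit of $\mathbf{x}$ is $\mathcal{O}_{\mathbf{f}}(\mathbf{x})=\{\mathbf{f}^n(\mathbf{x}):n\ge0\}$; it is periodic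 if $\mathbf{f}^{n+k}(\mathbf{x})=\mathbf{f}^n(\mathbf{x})$ for some $n\ge0,k>0$. A point $\mathbf{y}$ is a limit point of $\mathbf{x}$ under $\mathbf{f}$ if some subsequence $\mathbf{f}^{n_1}(\mathbf{x}),\mathbf{f}^{n_2}(\mathbf{x}),\dots$ ($n_1<n_2<\cdots$) converges to $\mathbf{y}$ in the Stone topology; $\omega_{\mathbf{f}}(\mathbf{x})$ is the set of limit points; $\mathbf{y}$ is recurrent if $\mathbf{y}\in\omega_{\mathbf{f}}(\mathbf{y})$. -}

module Defs where

open import Level using (Level; _⊔_) renaming (suc to lsuc)
open import Data.Nat using (ℕ; zero; suc; _<_; _≤_; _+_)
open import Data.Fin using (Fin)
open import Data.Bool using (Bool; true; false; not; _∧_)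
open import Data.Product using (Σ; ∃; _×_; _,_; proj₁; proj₂)
open import Data.Sum using (_⊎_)
open import Data.Unit using (⊤)
open import Data.Empty using (⊥)
open import Data.List using (List)
open import Data.List.Membership.Propositional using (_∈_)
open import Relation.Nullary using (¬_)
open import Relation.Binary.PropositionalEquality using (_≡_)
open import Function.Definitions using (Injective)

Countable : Set → Set
Countable A = Σ (A → ℕ) (λ e → Injective _≡_ _≡_ e)

data Form (Φ : Set) (nI : ℕ) : Set where
  ⊤′  : Form Φ nI
  atm : Φ → Form Φ nI
  ¬′_ : Form Φ nI → Form Φ nI
  _∧′_ : Form Φ nI → Form Φ nI → Form Φ nI
  □   : Fin nI → Form Φ nI → Form Φ nI

module Lang {Φ : Set} {nI : ℕ} where

  F : Set
  F = Form Φ nI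

  _⇒′_ : F → F → F
  φ ⇒′ ψ = ¬′ (φ ∧′ (¬′ ψ))

  _⇔′_ : F → F → F
  φ ⇔′ ψ = (φ ⇒′ ψ) ∧′ (ψ ⇒′ φ)

  -- Propositional evaluation, treating boxed formulas as atoms.
  evalP : (Φ → Bool) → (Fin nI → F → Bool) → F → Bool
  evalP va vb ⊤′        = true
  evalP va vb (atm p)   = va p
  evalP va vb (¬′ φ)    = not (evalP va vb φ)
  evalP va vb (φ ∧′ ψ)  = evalP va vb φ ∧ evalP va vb ψ
  evalP va vb (□ i φ)   = vb i φ

  Taut : F → Set
  Taut φ = ∀ va vb → evalP va vb φ ≡ true

  PropEntails : F → F → Set
  PropEntails φ ψ = ∀ va vb → evalP va vb φ ≡ true → evalP va vb ψ ≡ true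

  subst : (Φ → F) → F → F
  subst τ ⊤′       = ⊤′
  subst τ (atm p)  = τ p
  subst τ (¬′ φ)   = ¬′ subst τ φ
  subst τ (φ ∧′ ψ) = subst τ φ ∧′ subst τ ψ
  subst τ (□ i φ)  = □ i (subst τ φ)

  data IsBoolean : F → Set where
    b⊤ : IsBoolean ⊤′
    bp : ∀ p → IsBoolean (atm p)
    b¬ : ∀ {φ} → IsBoolean φ → IsBoolean (¬′ φ)
    b∧ : ∀ {φ ψ} → IsBoolean φ → IsBoolean ψ → IsBoolean (φ ∧′ ψ)

  data IsLitConj : F → Set where
    lpos : ∀ p → IsLitConj (atm p)
    lneg : ∀ p → IsLitConj (¬′ atm p)
    lcon : ∀ {φ ψ} → IsLitConj φ → IsLitConj ψ → IsLitConj (φ ∧′ ψ)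

  IsPost : F → Set
  IsPost φ = (φ ≡ ⊤′) ⊎ IsLitConj φ

  record IsNormalLogic (Λ : F → Set) : Set where
    field
      taut : ∀ φ → Taut φ → Λ φ
      axK  : ∀ i φ ψ → Λ (□ i (φ ⇒′ ψ) ⇒′ (□ i φ ⇒′ □ i ψ))
      mp   : ∀ φ ψ → Λ (φ ⇒′ ψ) → Λ φ → Λ ψ
      nec  : ∀ i φ → Λ φ → Λ (□ i φ)
      us   : ∀ τ φ → Λ φ → Λ (subst τ φ)

  record KModel : Set₁ where
    field
      S : Set
      R : Fin nI → S → S → Set
      V : Φ → S → Set

  open KModel public

  sat : (M : KModel) → S M → F → Set
  sat M s ⊤′        = ⊤
  sat M s (atm p)   = V M p s
  sat M s (¬′ φ)    = ¬ sat M s φ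
  sat M s (φ ∧′ ψ)  = sat M s φ × sat M s ψ
  sat M s (□ i φ)   = ∀ t → R M i s t → sat M t φ

  record PModel : Set₁ where
    constructor ⟨_,_⟩
    field
      model : KModel
      point : S model

  open PModel public

  _⊨_ : PModel → F → Set
  x ⊨ φ = sat (model x) (point x) φ

  _≈_ : PModel → PModel → Set
  x ≈ y = ∀ φ → (x ⊨ φ → y ⊨ φ) × (y ⊨ φ → x ⊨ φ)

  record ActionModel : Set₁ where
    field
      k    : ℕ
      Rσ   : Fin nI → Fin k → Fin k → Set
      pre  : Fin k → F
      post : Fin k → F
      postOK : ∀ σ → IsPost (post σ)
      Γ    : Fin k → Bool
      Γne  : ∃ λ σ → Γ σ ≡ true

  open ActionModel public

  -- states of a product update: pairs (s, σ) with M,s ⊨ pre σ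
  -- (proof irrelevant, so the state set is a genuine subset of S × Fin k)
  record PState (M : KModel) (A : ActionModel) : Set where
    constructor st
    field
      sS  : S M
      sσ  : Fin (k A)
      .ok : sat M sS (pre A sσ)

  open PState public

  _⊗_ : KModel → ActionModel → KModel
  M ⊗ A = record
    { S = PState M A
    ; R = λ i u v → R M i (sS u) (sS v) × Rσ A i (sσ u) (sσ v)
    ; V = λ p u →
          (V M p (sS u) × ¬ PropEntails (post A (sσ u)) (¬′ atm p))
          ⊎ PropEntails (post A (sσ u)) (atm p)
    }

  updAt : (x : PModel) (A : ActionModel) (σ : Fin (k A)) →
          x ⊨ pre A σ → PModel
  updAt x A σ h = ⟨ model x ⊗ A , st (point x) σ h ⟩

  -- Modal spaces: X is a set of pointed (countable) Kripke models;
  -- its points are taken up to modal equivalence (setoid reading).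

  module Space (X : PModel → Set₁) where

    Pt : Set₁
    Pt = Σ PModel X

    _≈ₚ_ : Pt → Pt → Set
    x ≈ₚ y = proj₁ x ≈ proj₁ y

    record SpaceMap : Set₁ where
      field
        fun  : Pt → Pt
        resp : ∀ x y → x ≈ₚ y → fun x ≈ₚ fun y

    open SpaceMap public

    PreconditionFinite : (F → Set) → ActionModel → Set
    PreconditionFinite Λ A =
      Σ (List F) λ L → ∀ σ → Σ F λ φ → (φ ∈ L) × Λ (pre A σ ⇔′ φ)

    Exhaustive : ActionModel → Set₁
    Exhaustive A = ∀ (x : Pt) → ∃ λ σ → (Γ A σ ≡ true) × (proj₁ x ⊨ pre A σ)

    Deterministic : ActionModel → Set₁
    Deterministic A = ∀ (x : Pt) σ σ′ → Γ A σ ≡ true → Γ A σ′ ≡ true →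
      proj₁ x ⊨ pre A σ → proj₁ x ⊨ pre A σ′ → σ ≡ σ′

    Closing : ActionModel → Set₁
    Closing A = ∀ (x : Pt) σ → Γ A σ ≡ true → (h : proj₁ x ⊨ pre A σ) →
      X (updAt (proj₁ x) A σ h)

    -- f is the clean map induced by A:  f(x̄) = ȳ  iff  x ⊗ A ∈ ȳ
    Induces : ActionModel → SpaceMap → Set₁
    Induces A f = ∀ (x : Pt) σ → Γ A σ ≡ true → (h : proj₁ x ⊨ pre A σ) →
      proj₁ (fun f x) ≈ updAt (proj₁ x) A σ h

    record IsClean (Λ : F → Set) (A : ActionModel) (f : SpaceMap) : Set₁ where
      field
        preFinite     : PreconditionFinite Λ A
        closing       : Closing A
        deterministic : Deterministic A
        exhaustive    : Exhaustive A
        induces       : Induces A f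

    iter : SpaceMap → ℕ → Pt → Pt
    iter f zero    x = x
    iter f (suc n) x = fun f (iter f n x)

    Periodic : SpaceMap → Pt → Set
    Periodic f x = Σ ℕ λ n → Σ ℕ λ m → (0 < m) × (iter f (n + m) x ≈ₚ iter f n x)

    -- convergence in the Stone topology (basic opens U_φ)
    Converges : (ℕ → Pt) → Pt → Set
    Converges seq y = ∀ φ → proj₁ y ⊨ φ →
      Σ ℕ λ N → ∀ m → N ≤ m → proj₁ (seq m) ⊨ φ

    StrictlyIncreasing : (ℕ → ℕ) → Set
    StrictlyIncreasing n = ∀ i → n i < n (suc i)

    LimitPoint : SpaceMap → Pt → Pt → Set
    LimitPoint f x y = Σ (ℕ → ℕ) λ n → StrictlyIncreasing n ×
      Converges (λ i → iter f (n i) x) y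

    Recurrent : SpaceMap → Pt → Set
    Recurrent f y = LimitPoint f y y

    OrbitHasRecurrent : SpaceMap → Pt → Set
    OrbitHasRecurrent f x = Σ ℕ λ n → Recurrent f (iter f n x)

record Prop11Witness (Φ : Set) (nI : ℕ) : Set₂ where
  open Lang {Φ} {nI}
  field
    Λ        : F → Set
    normal   : IsNormalLogic Λ
    X        : PModel → Set₁
    Xcount   : ∀ x → X x → Countable (S (model x))
    A        : ActionModel
    boolean  : ∀ σ → IsBoolean (pre A σ)
    nonStatic : ∃ λ σ → ¬ (post A σ ≡ ⊤′)
  open Space X
  field
    f        : SpaceMap
    clean    : IsClean Λ A f
    x        : Pt
    notPeriodic : ¬ Periodic f x
    recurrent   : OrbitHasRecurrent f x

-- Take one atom p and one agent, and let X consist of the countable pointed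
-- models that are bisimilar to the root of an infinite path whose n-th
-- vertex satisfies p according to a Boolean sequence b.  Reading b as a
-- binary number with least significant bit at the root, the action model
-- below propagates a carry along the path, so updating by it adds one: it
-- acts on X as the odometer.  The orbit of the all-false path runs through
-- the binary expansions of 0, 1, 2, ..., so it is not periodic.  A formula
-- of modal depth d only sees the first d + 1 vertices of a path, and after
-- 2^i steps the odometer has not changed the first i bits; hence the
-- iterates at times 2^i converge to the starting point, which is therefore
-- recurrent.

module Submission where

open import Data.Bool using (Bool; true; false; not; _∧_; _xor_; if_then_else_)
open import Data.Bool.Properties using (⇔→≡; xor-identityʳ; ∧-identityʳ; ∧-assoc)
  renaming (_≟_ to _≟ᵇ_)
open import Data.Empty using (⊥; ⊥-elim)
open import Data.Fin using (Fin; zero; suc; toℕ)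
open import Data.Fin.Properties using (toℕ-injective; toℕ<n; nonZeroIndex)
open import Data.List using (List; []; _∷_; map; allFin; foldr)
open import Data.List.Membership.Propositional.Properties using (∈-map⁺; ∈-allFin)
open import Data.Nat using (ℕ; zero; suc; _+_; _*_; _^_; _<_; _≤_; s≤s; z≤n; NonZero)
open import Data.Nat.DivMod using (_%_; [m+kn]%n≡m%n; m<n⇒m%n≡m)
open import Data.Nat.Properties
  using (+-identityʳ; +-suc; *-suc; +-cancelˡ-≡; *-cancelʳ-≡; ≤-trans; ≤-reflexive;
         m≤m+n; m≤n+m; +-monoʳ-≤; m+1+n≢m; n<1+n; ^-monoʳ-<)
open import Data.Product using (Σ; _×_; _,_; proj₁; proj₂)
open import Data.Product.Function.NonDependent.Propositional using (_×-cong_)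
open import Data.Sum using (inj₁; inj₂)
open import Data.Unit using (⊤; tt)
open import Function using (_∘_; id; const; _⇔_; mk⇔; Equivalence)
open import Function.Definitions using (Injective)
open import Function.Properties.Equivalence using ()
  renaming (refl to ⇔-refl; sym to ⇔-sym; trans to ⇔-trans)
open import Function.Related.TypeIsomorphisms using (¬-cong-⇔)
open import Relation.Binary.PropositionalEquality
  using (_≡_; refl; sym; trans; cong; cong₂; cong-app; _≗_; module ≡-Reasoning)
open import Relation.Nullary using (¬_)
open import Relation.Nullary.Decidable using (recompute)

open import Defs

open Equivalence using (to; from)

≡true-cong : ∀ {x y} → x ≡ y → (x ≡ true) ⇔ (y ≡ true)
≡true-cong x≡y = mk⇔ (trans (sym x≡y)) (trans x≡y)

toℕ+*%≡toℕ : ∀ {n} .{{_ : NonZero n}} (i : Fin n) m → (toℕ i + m * n) % n ≡ toℕ i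
toℕ+*%≡toℕ {n} i m = trans ([m+kn]%n≡m%n (toℕ i) m n) (m<n⇒m%n≡m (toℕ<n i))

toℕ+*-injective : ∀ {n} .{{_ : NonZero n}} (i j : Fin n) m m′ →
                  toℕ i + m * n ≡ toℕ j + m′ * n → i ≡ j × m ≡ m′
toℕ+*-injective {n} i j m m′ eq
  with toℕ-injective (trans (sym (toℕ+*%≡toℕ i m))
                            (trans (cong (_% n) eq) (toℕ+*%≡toℕ j m′)))
... | refl = refl , *-cancelʳ-≡ m m′ n (+-cancelˡ-≡ (toℕ i) _ _ eq)

module _ {Φ : Set} {nI : ℕ} where
  open Lang {Φ} {nI}

  data ⊢K : F → Set where
    taut : ∀ φ → Taut φ → ⊢K φ
    axK  : ∀ i φ ψ → ⊢K (□ i (φ ⇒′ ψ) ⇒′ (□ i φ ⇒′ □ i ψ))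
    mp   : ∀ φ ψ → ⊢K (φ ⇒′ ψ) → ⊢K φ → ⊢K ψ
    nec  : ∀ i φ → ⊢K φ → ⊢K (□ i φ)
    us   : ∀ τ φ → ⊢K φ → ⊢K (subst τ φ)

  ⊢K-normal : IsNormalLogic ⊢K
  ⊢K-normal = record { taut = taut ; axK = axK ; mp = mp ; nec = nec ; us = us }

  ⇔′-refl-taut : ∀ φ → Taut (φ ⇔′ φ)
  ⇔′-refl-taut φ va vb with evalP va vb φ
  ... | true  = refl
  ... | false = refl

  precondition-finite : ∀ {X Λ} → IsNormalLogic Λ → (A : ActionModel) →
                        Space.PreconditionFinite X Λ A
  precondition-finite Λ-normal A =
    map (pre A) (allFin (k A)) ,
    λ σ → pre A σ , ∈-map⁺ (pre A) (∈-allFin σ) ,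
          IsNormalLogic.taut Λ-normal _ (⇔′-refl-taut (pre A σ))

  ≈⇒⇔ : ∀ {x y} → x ≈ y → ∀ φ → x ⊨ φ ⇔ y ⊨ φ
  ≈⇒⇔ x≈y φ = mk⇔ (proj₁ (x≈y φ)) (proj₂ (x≈y φ))

  ⇔⇒≈ : ∀ {x y} → (∀ φ → x ⊨ φ ⇔ y ⊨ φ) → x ≈ y
  ⇔⇒≈ x⇔y φ = to (x⇔y φ) , from (x⇔y φ)

  ⊗-countable : ∀ {M} (A : ActionModel) → Countable (S M) → Countable (S (M ⊗ A))
  ⊗-countable {M} A (e , e-injective) = encode , encode-injective
    where
    encode : PState M A → ℕ
    encode u = toℕ (sσ u) + e (sS u) * k A

    encode-injective : Injective _≡_ _≡_ encode
    encode-injective {st s σ _} {st s′ σ′ _} eq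
      with toℕ+*-injective {{nonZeroIndex σ}} σ σ′ (e s) (e s′) eq
    ... | refl , es≡es′ with e-injective es≡es′
    ... | refl = refl

-- Path models

open Lang {⊤} {1}

p : F
p = atm tt

path : (ℕ → Bool) → KModel
path b = record { S = ℕ ; R = λ _ n m → m ≡ suc n ; V = λ _ n → b n ≡ true }

record PathBisim (M : KModel) (b : ℕ → Bool) : Set₁ where
  field
    Z     : S M → ℕ → Set
    val   : ∀ {s n} → Z s n → V M tt s ⇔ (b n ≡ true)
    forth : ∀ {s n t} → Z s n → R M zero s t → Z t (suc n)
    back  : ∀ {s n} → Z s n → Σ (S M) λ t → R M zero s t × Z t (suc n)

  sat-⇔ : ∀ φ {s n} → Z s n → sat M s φ ⇔ sat (path b) n φ
  sat-⇔ ⊤′             z = ⇔-refl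
  sat-⇔ (atm tt)       z = val z
  sat-⇔ (¬′ φ)         z = ¬-cong-⇔ (sat-⇔ φ z)
  sat-⇔ (φ ∧′ ψ)       z = sat-⇔ φ z ×-cong sat-⇔ ψ z
  sat-⇔ (□ zero φ) {n = n} z = mk⇔
    (λ h → λ { .(suc n) refl → let (t , r , z′) = back z in to (sat-⇔ φ z′) (h t r) })
    (λ h t r → from (sat-⇔ φ (forth z r)) (h (suc n) refl))
  sat-⇔ (□ (suc ()) φ) z

pathBisim : ∀ {b b′} → b ≗ b′ → PathBisim (path b) b′
pathBisim b≗b′ = record
  { Z     = _≡_
  ; val   = λ { {s} refl → ≡true-cong (b≗b′ s) }
  ; forth = λ { refl refl → refl }
  ; back  = λ { {s} refl → suc s , refl , refl }
  }

bitAt : ℕ → F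
bitAt zero    = p
bitAt (suc j) = □ zero (bitAt j)

sat-bitAt : ∀ b j k → sat (path b) k (bitAt j) ⇔ (b (k + j) ≡ true)
sat-bitAt b zero k rewrite +-identityʳ k = ⇔-refl
sat-bitAt b (suc j) k rewrite +-suc k j = mk⇔
  (λ h → to (sat-bitAt b j (suc k)) (h (suc k) refl))
  (λ h → λ { .(suc k) refl → from (sat-bitAt b j (suc k)) h })

depth : F → ℕ
depth ⊤′       = 0
depth (atm _)  = 0
depth (¬′ φ)   = depth φ
depth (φ ∧′ ψ) = depth φ + depth ψ
depth (□ _ φ)  = suc (depth φ)

sat-path-local : ∀ φ {b b′} k → (∀ j → j ≤ k + depth φ → b j ≡ b′ j) →
                 sat (path b) k φ ⇔ sat (path b′) k φ
sat-path-local ⊤′       k agree = ⇔-refl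
sat-path-local (atm tt) k agree = ≡true-cong (agree k (m≤m+n k 0))
sat-path-local (¬′ φ)   k agree = ¬-cong-⇔ (sat-path-local φ k agree)
sat-path-local (φ ∧′ ψ) k agree =
  sat-path-local φ k (λ j j≤ → agree j (≤-trans j≤ (+-monoʳ-≤ k (m≤m+n (depth φ) (depth ψ)))))
  ×-cong
  sat-path-local ψ k (λ j j≤ → agree j (≤-trans j≤ (+-monoʳ-≤ k (m≤n+m (depth ψ) (depth φ)))))
sat-path-local (□ zero φ) {b} {b′} k agree = mk⇔
  (λ h → λ { .(suc k) refl → to   next (h (suc k) refl) })
  (λ h → λ { .(suc k) refl → from next (h (suc k) refl) })
  where
  next : sat (path b) (suc k) φ ⇔ sat (path b′) (suc k) φ
  next = sat-path-local φ (suc k)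
           (λ j j≤ → agree j (≤-trans j≤ (≤-reflexive (sym (+-suc k (depth φ))))))
sat-path-local (□ (suc ()) φ) k agree

record PathLike (y : PModel) : Set₁ where
  field
    seq       : ℕ → Bool
    bisim     : PathBisim (model y) seq
    at-root   : PathBisim.Z bisim (point y) 0
    countable : Countable (S (model y))

  sat-⇔-path : ∀ φ → y ⊨ φ ⇔ sat (path seq) 0 φ
  sat-⇔-path φ = PathBisim.sat-⇔ bisim φ at-root

  bit-⇔ : ∀ j → y ⊨ bitAt j ⇔ (seq j ≡ true)
  bit-⇔ j = ⇔-trans (sat-⇔-path (bitAt j)) (sat-bitAt seq j 0)

open PathLike

pathLike : ∀ b → PathLike ⟨ path b , 0 ⟩
pathLike b = record
  { seq = b ; bisim = pathBisim (λ _ → refl) ; at-root = refl ; countable = id , id }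

≗⇒≈ : ∀ {x y} (dx : PathLike x) (dy : PathLike y) → seq dx ≗ seq dy → x ≈ y
≗⇒≈ dx dy eq = ⇔⇒≈ λ φ →
  ⇔-trans (sat-⇔-path dx φ)
    (⇔-trans (PathBisim.sat-⇔ (pathBisim eq) φ refl) (⇔-sym (sat-⇔-path dy φ)))

≈⇒≗ : ∀ {x y} (dx : PathLike x) (dy : PathLike y) → x ≈ y → seq dx ≗ seq dy
≈⇒≗ dx dy x≈y j =
  ⇔→≡ (⇔-trans (⇔-sym (bit-⇔ dx j)) (⇔-trans (≈⇒⇔ x≈y (bitAt j)) (bit-⇔ dy j)))

-- The odometer on Boolean sequences

infixr 5 _◂_

_◂_ : Bool → (ℕ → Bool) → ℕ → Bool
(b ◂ a) zero    = b
(b ◂ a) (suc m) = a m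

◂-η : ∀ a → a ≗ a 0 ◂ a ∘ suc
◂-η a zero    = refl
◂-η a (suc m) = refl

◂-cong : ∀ b {a a′} → a ≗ a′ → b ◂ a ≗ b ◂ a′
◂-cong b a≗a′ zero    = refl
◂-cong b a≗a′ (suc m) = a≗a′ m

zeros : ℕ → Bool
zeros _ = false

carry : (ℕ → Bool) → ℕ → Bool
carry a zero    = true
carry a (suc m) = carry a m ∧ a m

odo : (ℕ → Bool) → ℕ → Bool
odo a m = a m xor carry a m

carry-cong : ∀ {a a′} → a ≗ a′ → carry a ≗ carry a′
carry-cong a≗a′ zero    = refl
carry-cong a≗a′ (suc m) = cong₂ _∧_ (carry-cong a≗a′ m) (a≗a′ m)

odo-cong : ∀ {a a′} → a ≗ a′ → odo a ≗ odo a′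
odo-cong a≗a′ m = cong₂ _xor_ (a≗a′ m) (carry-cong a≗a′ m)

carry-◂ : ∀ b a m → carry (b ◂ a) (suc m) ≡ b ∧ carry a m
carry-◂ b a zero    = sym (∧-identityʳ b)
carry-◂ b a (suc m) = trans (cong (_∧ a m) (carry-◂ b a m)) (∧-assoc b (carry a m) (a m))

odo-false◂ : ∀ a → odo (false ◂ a) ≗ true ◂ a
odo-false◂ a zero    = refl
odo-false◂ a (suc m) = trans (cong (a m xor_) (carry-◂ false a m)) (xor-identityʳ (a m))

odo-true◂ : ∀ a → odo (true ◂ a) ≗ false ◂ odo a
odo-true◂ a zero    = refl
odo-true◂ a (suc m) = cong (a m xor_) (carry-◂ true a m)

odo²-◂ : ∀ b a → odo (odo (b ◂ a)) ≗ b ◂ odo a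
odo²-◂ false a m = trans (odo-cong (odo-false◂ a) m) (odo-true◂ a m)
odo²-◂ true  a m = trans (odo-cong (odo-true◂ a) m) (odo-false◂ (odo a) m)

odo^ : ℕ → (ℕ → Bool) → ℕ → Bool
odo^ zero    a = a
odo^ (suc n) a = odo (odo^ n a)

odo^-cong : ∀ n {a a′} → a ≗ a′ → odo^ n a ≗ odo^ n a′
odo^-cong zero    a≗a′ = a≗a′
odo^-cong (suc n) a≗a′ = odo-cong (odo^-cong n a≗a′)

odo^-double : ∀ n b a → odo^ (2 * n) (b ◂ a) ≗ b ◂ odo^ n a
odo^-double zero    b a m = refl
odo^-double (suc n) b a m = begin
  odo^ (2 * suc n) (b ◂ a) m          ≡⟨ cong (λ k → odo^ k (b ◂ a) m) (*-suc 2 n) ⟩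
  odo (odo (odo^ (2 * n) (b ◂ a))) m  ≡⟨ odo-cong (odo-cong (odo^-double n b a)) m ⟩
  odo (odo (b ◂ odo^ n a)) m          ≡⟨ odo²-◂ b (odo^ n a) m ⟩
  (b ◂ odo^ (suc n) a) m              ∎
  where open ≡-Reasoning

odo^-2^-prefix : ∀ i a j → j < i → odo^ (2 ^ i) a j ≡ a j
odo^-2^-prefix (suc i) a j j<1+i =
  trans (odo^-cong (2 ^ suc i) (◂-η a) j)
    (trans (odo^-double (2 ^ i) (a 0) (a ∘ suc) j) (low j j<1+i))
  where
  low : ∀ j → j < suc i → (a 0 ◂ odo^ (2 ^ i) (a ∘ suc)) j ≡ a j
  low zero    _         = refl
  low (suc j) (s≤s j<i) = odo^-2^-prefix i (a ∘ suc) j j<i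

⟦_⟧ : List Bool → ℕ → Bool
⟦_⟧ = foldr _◂_ zeros

inc : List Bool → List Bool
inc []          = true ∷ []
inc (false ∷ l) = true ∷ l
inc (true ∷ l)  = false ∷ inc l

binary : ℕ → List Bool
binary zero    = []
binary (suc n) = inc (binary n)

push : Bool → ℕ → ℕ
push b v = (if b then 1 else 0) + 2 * v

value : List Bool → ℕ
value = foldr push 0

odo-⟦⟧ : ∀ l → odo ⟦ l ⟧ ≗ ⟦ inc l ⟧
odo-⟦⟧ []          m = trans (odo-cong (◂-η zeros) m) (odo-false◂ zeros m)
odo-⟦⟧ (false ∷ l) m = odo-false◂ ⟦ l ⟧ m
odo-⟦⟧ (true ∷ l)  m = trans (odo-true◂ ⟦ l ⟧ m) (◂-cong false (odo-⟦⟧ l) m)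

odo^-zeros : ∀ n → odo^ n zeros ≗ ⟦ binary n ⟧
odo^-zeros zero    m = refl
odo^-zeros (suc n) m = trans (odo-cong (odo^-zeros n) m) (odo-⟦⟧ (binary n) m)

value-inc : ∀ l → value (inc l) ≡ suc (value l)
value-inc []          = refl
value-inc (false ∷ l) = refl
value-inc (true ∷ l) rewrite value-inc l = *-suc 2 (value l)

value-binary : ∀ n → value (binary n) ≡ n
value-binary zero    = refl
value-binary (suc n) = trans (value-inc (binary n)) (cong suc (value-binary n))

-- [] is treated as false ∷ [], which has the same value and denotation.
value-cong : ∀ l l′ → ⟦ l ⟧ ≗ ⟦ l′ ⟧ → value l ≡ value l′
value-cong []      []        eq = refl
value-cong []      (b′ ∷ l′) eq = cong₂ push (eq 0) (value-cong [] l′ (eq ∘ suc))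
value-cong (b ∷ l) []        eq = cong₂ push (eq 0) (value-cong l [] (eq ∘ suc))
value-cong (b ∷ l) (b′ ∷ l′) eq = cong₂ push (eq 0) (value-cong l l′ (eq ∘ suc))

odo^-zeros-injective : ∀ m n → odo^ m zeros ≗ odo^ n zeros → m ≡ n
odo^-zeros-injective m n eq = begin
  m                 ≡⟨ sym (value-binary m) ⟩
  value (binary m)  ≡⟨ value-cong (binary m) (binary n) binary-m≗binary-n ⟩
  value (binary n)  ≡⟨ value-binary n ⟩
  n                 ∎
  where
  open ≡-Reasoning
  binary-m≗binary-n : ⟦ binary m ⟧ ≗ ⟦ binary n ⟧
  binary-m≗binary-n j = trans (sym (odo^-zeros m j)) (trans (eq j) (odo^-zeros n j))

-- The counter action model

-- The action at vertex m of a path records whether the carry reaches m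
-- and, if it does, the bit found there.
pattern flip₁ = zero
pattern flip₀ = suc zero
pattern keep  = suc (suc zero)

_⇝_ : Fin 3 → Fin 3 → Set
flip₁ ⇝ flip₁ = ⊤
flip₁ ⇝ flip₀ = ⊤
flip₀ ⇝ keep  = ⊤
keep  ⇝ keep  = ⊤
_     ⇝ _     = ⊥

preᶜ : Fin 3 → F
preᶜ flip₁ = p
preᶜ flip₀ = ¬′ p
preᶜ keep  = ⊤′

postᶜ : Fin 3 → F
postᶜ flip₁ = ¬′ p
postᶜ flip₀ = p
postᶜ keep  = ⊤′

postᶜ-ok : ∀ σ → IsPost (postᶜ σ)
postᶜ-ok flip₁ = inj₂ (lneg tt)
postᶜ-ok flip₀ = inj₂ (lpos tt)
postᶜ-ok keep  = inj₁ refl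

Γᶜ : Fin 3 → Bool
Γᶜ flip₁ = true
Γᶜ flip₀ = true
Γᶜ keep  = false

counter : ActionModel
counter = record
  { k = 3 ; Rσ = λ _ → _⇝_ ; pre = preᶜ ; post = postᶜ ; postOK = postᶜ-ok
  ; Γ = Γᶜ ; Γne = flip₁ , refl }

action : Bool → Bool → Fin 3
action true  true  = flip₁
action true  false = flip₀
action false _     = keep

enabled : Fin 3 → Bool → Bool
enabled flip₁ b = b
enabled flip₀ b = not b
enabled keep  _ = true

written : Fin 3 → Bool → Bool
written flip₁ _ = false
written flip₀ _ = true
written keep  b = b

written-action : ∀ c b → written (action c b) b ≡ b xor c
written-action true  true  = refl
written-action true  false = refl
written-action false b     = sym (xor-identityʳ b)

enabled-action : ∀ c b → enabled (action c b) b ≡ true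
enabled-action true  true  = refl
enabled-action true  false = refl
enabled-action false b     = refl

action-⇝ : ∀ c b b′ → action c b ⇝ action (c ∧ b) b′
action-⇝ true  true  true  = tt
action-⇝ true  true  false = tt
action-⇝ true  false b′    = tt
action-⇝ false b     b′    = tt

action-⇝-unique : ∀ c b b′ τ → action c b ⇝ τ → enabled τ b′ ≡ true → τ ≡ action (c ∧ b) b′
action-⇝-unique true  true  true  flip₁ _ _  = refl
action-⇝-unique true  true  false flip₁ _ ()
action-⇝-unique true  true  true  flip₀ _ ()
action-⇝-unique true  true  false flip₀ _ _  = refl
action-⇝-unique true  false b′    keep  _ _  = refl
action-⇝-unique false b     b′    keep  _ _  = refl

action-root : ∀ b σ → Γᶜ σ ≡ true → enabled σ b ≡ true → σ ≡ action true b
action-root true  flip₁ _ _  = refl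
action-root false flip₁ _ ()
action-root true  flip₀ _ ()
action-root false flip₀ _ _  = refl
action-root b     keep  () _

Γ-action : ∀ b → Γᶜ (action true b) ≡ true
Γ-action true  = refl
Γ-action false = refl

¬≡true⇔not≡true : ∀ b → (¬ b ≡ true) ⇔ (not b ≡ true)
¬≡true⇔not≡true true  = mk⇔ (λ b≢true → ⊥-elim (b≢true refl)) (λ ())
¬≡true⇔not≡true false = mk⇔ (const refl) (λ _ ())

pre-⇔ : ∀ {M t b} → V M tt t ⇔ (b ≡ true) → ∀ τ → sat M t (preᶜ τ) ⇔ (enabled τ b ≡ true)
pre-⇔         v⇔b flip₁ = v⇔b
pre-⇔ {b = b} v⇔b flip₀ = ⇔-trans (¬-cong-⇔ v⇔b) (¬≡true⇔not≡true b)
pre-⇔         v⇔b keep  = mk⇔ (const refl) (const tt)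

countermodel⇒¬PropEntails : ∀ {φ ψ} va vb →
                            evalP va vb φ ≡ true → evalP va vb ψ ≡ false → ¬ PropEntails φ ψ
countermodel⇒¬PropEntails va vb φ-true ψ-false φ⊨ψ
  with trans (sym ψ-false) (φ⊨ψ va vb φ-true)
... | ()

¬p⊭p : ¬ PropEntails (¬′ p) p
¬p⊭p = countermodel⇒¬PropEntails {¬′ p} {p} (const false) (λ _ _ → false) refl refl

⊤⊭p : ¬ PropEntails ⊤′ p
⊤⊭p = countermodel⇒¬PropEntails {⊤′} {p} (const false) (λ _ _ → false) refl refl

⊤⊭¬p : ¬ PropEntails ⊤′ (¬′ p)
⊤⊭¬p = countermodel⇒¬PropEntails {⊤′} {¬′ p} (const true) (λ _ _ → false) refl refl

updated-val-⇔ : ∀ {M t b} → V M tt t ⇔ (b ≡ true) → ∀ τ .(ok : sat M t (preᶜ τ)) →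
                V (M ⊗ counter) tt (st t τ ok) ⇔ (written τ b ≡ true)
updated-val-⇔ v⇔b flip₁ ok = mk⇔
  (λ { (inj₁ (_ , ¬p⊭¬p)) → ⊥-elim (¬p⊭¬p (λ _ _ → id)) ; (inj₂ ¬p⊨p) → ⊥-elim (¬p⊭p ¬p⊨p) })
  (λ ())
updated-val-⇔ v⇔b flip₀ ok = mk⇔ (const refl) (const (inj₂ (λ _ _ → id)))
updated-val-⇔ v⇔b keep  ok = mk⇔
  (λ { (inj₁ (v , _)) → to v⇔b v ; (inj₂ ⊤⊨p) → ⊥-elim (⊤⊭p ⊤⊨p) })
  (λ b≡true → inj₁ (from v⇔b b≡true , ⊤⊭¬p))

module Update {y : PModel} (d : PathLike y) where
  open PathBisim (bisim d)

  Z′ : PState (model y) counter → ℕ → Set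
  Z′ u m = Z (sS u) m × sσ u ≡ action (carry (seq d) m) (seq d m)

  bisim′ : PathBisim (model y ⊗ counter) (odo (seq d))
  bisim′ = record
    { Z     = Z′
    ; val   = λ {u m} → val′ {u} {m}
    ; forth = λ {u m v} → forth′ {u} {m} {v}
    ; back  = λ {u m} → back′ {u} {m}
    }
    where
    a : ℕ → Bool
    a = seq d

    val′ : ∀ {u m} → Z′ u m → V (model y ⊗ counter) tt u ⇔ (odo a m ≡ true)
    val′ {st s _ ok} {m} (z , refl) =
      ⇔-trans (updated-val-⇔ (val z) _ ok) (≡true-cong (written-action (carry a m) (a m)))

    forth′ : ∀ {u m v} → Z′ u m → R (model y ⊗ counter) zero u v → Z′ v (suc m)
    forth′ {st s _ _} {m} {st t τ ok} (z , refl) (r , τ₀⇝τ) =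
      forth z r ,
      action-⇝-unique (carry a m) (a m) (a (suc m)) τ τ₀⇝τ
        (recompute (enabled τ (a (suc m)) ≟ᵇ true) (to (pre-⇔ (val (forth z r)) τ) ok))

    back′ : ∀ {u m} → Z′ u m → Σ (PState (model y) counter) λ v →
            R (model y ⊗ counter) zero u v × Z′ v (suc m)
    back′ {st s _ _} {m} (z , refl) =
      let (t , r , z′) = back z
          τ = action (carry a (suc m)) (a (suc m))
      in st t τ (from (pre-⇔ (val z′) τ) (enabled-action (carry a (suc m)) (a (suc m)))) ,
         (r , action-⇝ (carry a m) (a m) (a (suc m))) , (z′ , refl)

  updated : ∀ σ → Γᶜ σ ≡ true → (h : y ⊨ preᶜ σ) → PathLike (updAt y counter σ h)
  updated σ σ∈Γ h = record
    { seq       = odo (seq d)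
    ; bisim     = bisim′
    ; at-root   = at-root d , action-root (seq d 0) σ σ∈Γ (to (pre-⇔ (val (at-root d)) σ) h)
    ; countable = ⊗-countable counter (countable d)
    }

open Space PathLike

pathPoint : (ℕ → Bool) → Pt
pathPoint b = ⟨ path b , 0 ⟩ , pathLike b

odometer : SpaceMap
odometer = record
  { fun  = λ x → pathPoint (odo (seq (proj₂ x)))
  ; resp = λ x y x≈y → ≗⇒≈ (pathLike _) (pathLike _) (odo-cong (≈⇒≗ (proj₂ x) (proj₂ y) x≈y))
  }

odometer-clean : IsClean ⊢K counter odometer
odometer-clean = record
  { preFinite     = precondition-finite {X = PathLike} ⊢K-normal counter
  ; closing       = λ x → Update.updated (proj₂ x)
  ; deterministic = deterministic
  ; exhaustive    = exhaustive
  ; induces       = λ x σ σ∈Γ h → ≗⇒≈ (pathLike _) (Update.updated (proj₂ x) σ σ∈Γ h) (λ _ → refl)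
  }
  where
  deterministic : Deterministic counter
  deterministic _ flip₁ flip₁ _  _  _  _  = refl
  deterministic _ flip₁ flip₀ _  _  v  ¬v = ⊥-elim (¬v v)
  deterministic _ flip₀ flip₁ _  _  ¬v v  = ⊥-elim (¬v v)
  deterministic _ flip₀ flip₀ _  _  _  _  = refl
  deterministic _ keep  _     () _  _  _
  deterministic _ _     keep  _  () _  _

  exhaustive : Exhaustive counter
  exhaustive (y , d) =
    action true b , Γ-action b ,
    from (pre-⇔ (PathBisim.val (bisim d) (at-root d)) (action true b)) (enabled-action true b)
    where
    b : Bool
    b = seq d 0

-- The orbit of the all-false path

seq-iter : ∀ n x → seq (proj₂ (iter odometer n x)) ≡ odo^ n (seq (proj₂ x))
seq-iter zero    x = refl
seq-iter (suc n) x = cong odo (seq-iter n x)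

x₀ : Pt
x₀ = pathPoint zeros

orbit-≈⇒≗ : ∀ m n x → iter odometer m x ≈ₚ iter odometer n x →
            odo^ m (seq (proj₂ x)) ≗ odo^ n (seq (proj₂ x))
orbit-≈⇒≗ m n x fᵐx≈fⁿx j =
  trans (sym (cong-app (seq-iter m x) j))
    (trans (≈⇒≗ (proj₂ (iter odometer m x)) (proj₂ (iter odometer n x)) fᵐx≈fⁿx j)
           (cong-app (seq-iter n x) j))

x₀-not-periodic : ¬ Periodic odometer x₀
x₀-not-periodic (n , suc m , _ , period) =
  m+1+n≢m n (odo^-zeros-injective (n + suc m) n (orbit-≈⇒≗ (n + suc m) n x₀ period))

prefix-convergence : (s : ℕ → Pt) (y : Pt) →
                     (∀ i j → j < i → seq (proj₂ (s i)) j ≡ seq (proj₂ y) j) → Converges s y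
prefix-convergence s (y , d) agree φ y⊨φ = suc (depth φ) , λ i depth<i →
  from (sat-⇔-path (proj₂ (s i)) φ)
    (to (sat-path-local φ 0 (λ j j≤depth → sym (agree i j (≤-trans (s≤s j≤depth) depth<i))))
        (to (sat-⇔-path d φ) y⊨φ))

x₀-recurrent : Recurrent odometer x₀
x₀-recurrent =
  (2 ^_) , (λ i → ^-monoʳ-< 2 (s≤s (s≤s z≤n)) (n<1+n i)) ,
  prefix-convergence (λ i → iter odometer (2 ^ i) x₀) x₀ λ i j j<i →
    trans (cong-app (seq-iter (2 ^ i) x₀) j) (odo^-2^-prefix i zeros j j<i)

proposition11 : Σ Set λ Φ → Σ (Countable Φ) λ _ → Σ ℕ λ nI → Prop11Witness Φ nI
proposition11 = ⊤ , (const 0 , λ _ → refl) , 1 , record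
  { Λ           = ⊢K
  ; normal      = ⊢K-normal
  ; X           = PathLike
  ; Xcount      = λ _ → countable
  ; A           = counter
  ; boolean     = λ { flip₁ → bp tt ; flip₀ → b¬ (bp tt) ; keep → b⊤ }
  ; nonStatic   = flip₁ , λ ()
  ; f           = odometer
  ; clean       = odometer-clean
  ; x           = x₀
  ; notPeriodic = x₀-not-periodic
  ; recurrent   = 0 , x₀-recurrent
  }
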